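{- Let $\nu$ be a vertex of a graph $G$ and $\epsilon=(\alpha,\beta,\alpha\beta)$ an embedding of $G$ in which $\nu$ is incident to the $q$ faces $f_1,\dots,f_q$. Let $\epsilon'=(\alpha,\beta',\alpha\beta')$ be obtained by reembedding $\nu$, and suppose $\nu$ is incident to the $q'$ faces $f'_1,\dots,f'_{q'}$ of $\epsilon'$. Then $$\bigcup_{i=1}^q H(f_i)=\bigcup_{i=1}^{q'}H(f'_i)\quad\text{and}\quad q\equiv q'\pmod 2.$$
   Context: A map with $m$ edges is a triple $(\alpha,\beta,\gamma)$ of permutations of $[2m]$ (half-edges), $\alpha$ a fixed-point-free involution (edges), cycles of $\beta$ the cyclic orders of half-edges around vertices, and $\gamma=\alpha\beta$ whose cycles are the faces. The graph is $G=(\alpha,Par_\beta)$, its vertices the blocks of $Par_\beta$ (partition into cycles of $\beta$). An embedding of $G$ is a map $(\alpha,\beta',\alpha\beta')$ with $Par_{\beta'}=Par_\beta$. $H(f)$ is the set of half-edges in the face (cycle of $\gamma$) $f$; a face $f$ is incident to $\nu$ if $H(f)\cap\nu\neq\emptyset$. Reembedding $\nu$ means replacing $\beta$ by $\beta'$ with $\beta'(x)=\beta(x)$ for $x\notin\nu$ and $\beta'|_\nu$ a single cycle on $\nu$. -}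

module Defs where

open import Data.Nat using (ℕ; zero; suc)
open import Data.Fin using (Fin)
open import Data.Fin.Permutation using (Permutation′; _⟨$⟩ʳ_)
open import Data.Product using (Σ; ∃; _×_; _,_)
open import Relation.Binary.PropositionalEquality using (_≡_; _≢_)
open import Relation.Nullary using (¬_)

iter : {A : Set} → (A → A) → ℕ → A → A
iter f zero    x = x
iter f (suc k) x = f (iter f k x)

SameCycle : {n : ℕ} → Permutation′ n → Fin n → Fin n → Set
SameCycle π x y = ∃ λ k → iter (π ⟨$⟩ʳ_) k x ≡ y

FPFInvolution : {n : ℕ} → Permutation′ n → Set
FPFInvolution α = ∀ x → (α ⟨$⟩ʳ (α ⟨$⟩ʳ x) ≡ x) × (α ⟨$⟩ʳ x ≢ x)

faceStep : {n : ℕ} → Permutation′ n → Permutation′ n → Fin n → Fin n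
faceStep α β x = α ⟨$⟩ʳ (β ⟨$⟩ʳ x)

SameFace : {n : ℕ} → Permutation′ n → Permutation′ n → Fin n → Fin n → Set
SameFace α β x y = ∃ λ k → iter (faceStep α β) k x ≡ y

-- the vertex ν of the map, given by a half-edge v of it: ν = cycle of β through v
InVertex : {n : ℕ} → Permutation′ n → Fin n → Fin n → Set
InVertex β v x = SameCycle β v x

FaceIncident : {n : ℕ} → Permutation′ n → Permutation′ n → Fin n → Fin n → Set
FaceIncident α β v x = ∃ λ y → InVertex β v y × SameFace α β x y

-- ν is incident to exactly the q faces f₁,…,f_q, given by representative
-- half-edges f i: each is incident to ν, they are pairwise distinct faces,
-- and every face incident to ν is one of them.
IncidentFaces : {n : ℕ} → Permutation′ n → Permutation′ n → Fin n →
                (q : ℕ) → (Fin q → Fin n) → Set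
IncidentFaces {n} α β v q f =
  (∀ i → FaceIncident α β v (f i)) ×
  (∀ i j → SameFace α β (f i) (f j) → i ≡ j) ×
  (∀ (x : Fin n) → FaceIncident α β v x → ∃ λ i → SameFace α β (f i) x)

-- β' is obtained from β by reembedding the vertex ν (the β-cycle through v):
-- β' agrees with β off ν, and β' restricted to ν is a single cycle on ν.
Reembedding : {n : ℕ} → Permutation′ n → Fin n → Permutation′ n → Set
Reembedding β v β' =
  (∀ x → ¬ InVertex β v x → β' ⟨$⟩ʳ x ≡ β ⟨$⟩ʳ x) ×
  (∀ x → InVertex β v x → InVertex β v (β' ⟨$⟩ʳ x)) ×
  (∀ x → InVertex β v x → SameCycle β' v x)

-- Faces of the map (α, β) are the cycles of γ = αβ; the faces at ν form a
-- region of half-edges that is a union of γ-cycles.  Reembedding changes β,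
-- hence γ, only on ν, and a γ-orbit that meets ν is followed identically by
-- the new face permutation γ' until it first enters ν (orbit-enters); so the
-- region is the same for γ and γ', which is the first claim.
--
-- For the parity write c(π) for the number of cycles of a permutation π.
--  * Two permutations agreeing outside an invariant region have the same
--    cycles outside it (LocalChange).  Hence c(γ) + q' = c(γ') + q, and
--    c(β) = c(β') since β and β' both have the single cycle ν on ν.
--  * Composing with a transposition changes c by one (cycleParity-transpose),
--    and permutations are products of transpositions, so the parity of
--    c(σ ∘ π) depends only on those of c(σ) and c(π) (cycleParity-∘).
-- Therefore c(γ) ≡ c(γ') and q ≡ q' (mod 2).
module Submission where

open import Defs
open import Data.Empty using (⊥-elim)
open import Data.Fin using (Fin; zero; suc; toℕ; fromℕ<; punchIn)
open import Data.Fin.Permutation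
  using (Permutation′; _⟨$⟩ʳ_; _⟨$⟩ˡ_; inverseˡ; inverseʳ; _∘ₚ_; id; transpose; remove; lift₀-transpose)
  renaming (_≈_ to _≈ₚ_)
import Data.Fin.Permutation.Components as PC
open import Data.Fin.Permutation.Transposition.List
  using (TranspositionList; eval; decompose; eval-decompose)
open import Data.Fin.Properties
  using (pigeonhole; toℕ<n; toℕ-fromℕ<; any?; punchIn-punchOut; suc-injective; 0≢1+n)
  renaming (_≟_ to _≟ᶠ_)
open import Data.List using (List; []; _∷_; length; filter; _++_; map; tabulate)
open import Data.List.Properties using (length-removeAt′; length-map; length-++; length-tabulate)
open import Data.List.Relation.Unary.All as All using (All; []; _∷_)
import Data.List.Relation.Unary.All.Properties as AllP
open import Data.List.Relation.Unary.AllPairs as AP using (AllPairs; []; _∷_)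
import Data.List.Relation.Unary.AllPairs.Properties as APP
open import Data.List.Relation.Unary.Any as Any using (Any; here; there; _─_)
import Data.List.Relation.Unary.Any.Properties as AnyP
open import Data.Nat using (ℕ; zero; suc; _+_; _*_; _∸_; _≤_; _<_; z≤n; s≤s; _%_; _/_; parity)
open import Data.Nat.DivMod using (m≡m%n+[m/n]*n; m%n<n)
open import Data.Nat.Properties
  using (+-comm; +-assoc; +-cancelʳ-≡; *-suc; m∸n+n≡m; m∸n≤m; m<n⇒0<n∸m;
         ≤-refl; ≤-trans; <-≤-trans; <⇒≤; ≤-pred; ≤-antisym)
open import Data.Parity.Base using (Parity; 0ℙ; 1ℙ; _⁻¹) renaming (_+_ to _+ℙ_)
import Data.Parity.Properties as ℙ
open import Data.Product using (Σ; ∃; _×_; _,_; proj₁; proj₂)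
open import Data.Sum using (_⊎_; inj₁; inj₂)
open import Data.Unit using (⊤; tt)
open import Function using (_∘_)
open import Function.Bundles using (_⇔_; mk⇔; Equivalence)
open import Function.Properties.Equivalence using () renaming (trans to ⇔-trans; sym to ⇔-sym)
open import Level using (0ℓ)
open import Relation.Binary.Bundles using (Setoid)
open import Relation.Binary.PropositionalEquality
open import Relation.Nullary using (¬_; Dec; yes; no; ¬?)
open import Relation.Nullary.Decidable using (_×-dec_; toSum)
open import Relation.Unary using (Decidable)

module _ {A : Set} (g : A → A) where

  iter-+ : ∀ a b x → iter g (a + b) x ≡ iter g a (iter g b x)
  iter-+ zero    b x = refl
  iter-+ (suc a) b x = cong g (iter-+ a b x)

  iter-suc : ∀ k x → iter g (suc k) x ≡ iter g k (g x)
  iter-suc k x = trans (cong (λ z → iter g z x) (+-comm 1 k)) (iter-+ k 1 x)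

  iter-periodic : ∀ p x → iter g p x ≡ x → ∀ k → iter g (k * p) x ≡ x
  iter-periodic p x e zero    = refl
  iter-periodic p x e (suc k) =
    trans (iter-+ p (k * p) x) (trans (cong (iter g p) (iter-periodic p x e k)) e)

perm-injective : ∀ {n} (π : Permutation′ n) {x y} → π ⟨$⟩ʳ x ≡ π ⟨$⟩ʳ y → x ≡ y
perm-injective π e = trans (sym (inverseˡ π)) (trans (cong (π ⟨$⟩ˡ_) e) (inverseˡ π))

preimage : ∀ {n} (π : Permutation′ n) {x y} → π ⟨$⟩ˡ y ≡ x → π ⟨$⟩ʳ x ≡ y
preimage π e = trans (cong (π ⟨$⟩ʳ_) (sym e)) (inverseʳ π)

-- Symmetry and decidability rest on every point
-- being periodic with period at most n (pigeonhole principle).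
module Cycles {n : ℕ} (π : Permutation′ n) where

  private
    P : Fin n → Fin n
    P = π ⟨$⟩ʳ_

  iter-injective : ∀ k {x y} → iter P k x ≡ iter P k y → x ≡ y
  iter-injective zero    e = e
  iter-injective (suc k) e = iter-injective k (perm-injective π e)

  -- Two of x, P x, …, Pⁿ x coincide; by injectivity this gives a period.
  period : ∀ x → ∃ λ p → 0 < p × p ≤ n × iter P p x ≡ x
  period x with pigeonhole ≤-refl (λ (i : Fin (suc n)) → iter P (toℕ i) x)
  ... | i , j , i<j , e =
    d , m<n⇒0<n∸m i<j , ≤-trans (m∸n≤m (toℕ j) (toℕ i)) (≤-pred (toℕ<n j)) ,
    iter-injective (toℕ i) shifted
    where
    open ≡-Reasoning
    d = toℕ j ∸ toℕ i
    shifted : iter P (toℕ i) (iter P d x) ≡ iter P (toℕ i) x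
    shifted = begin
      iter P (toℕ i) (iter P d x) ≡⟨ sym (iter-+ P (toℕ i) d x) ⟩
      iter P (toℕ i + d) x        ≡⟨ cong (λ z → iter P z x) (+-comm (toℕ i) d) ⟩
      iter P (d + toℕ i) x        ≡⟨ cong (λ z → iter P z x) (m∸n+n≡m (<⇒≤ i<j)) ⟩
      iter P (toℕ j) x            ≡⟨ sym e ⟩
      iter P (toℕ i) x            ∎

  refl-cycle : ∀ {x} → SameCycle π x x
  refl-cycle = 0 , refl

  step-cycle : ∀ x → SameCycle π x (P x)
  step-cycle x = 1 , refl

  trans-cycle : ∀ {x y z} → SameCycle π x y → SameCycle π y z → SameCycle π x z
  trans-cycle {x} (a , e) (b , e') = b + a , trans (iter-+ P b a x) (trans (cong (iter P b) e) e')

  -- Going k steps back is going k·(p - 1) steps forward, p a period.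
  sym-cycle : ∀ {x y} → SameCycle π x y → SameCycle π y x
  sym-cycle {x} {y} (k , e) with period x
  ... | suc p , _ , _ , ep = k * p , (begin
      iter P (k * p) y            ≡⟨ cong (iter P (k * p)) (sym e) ⟩
      iter P (k * p) (iter P k x) ≡⟨ sym (iter-+ P (k * p) k x) ⟩
      iter P (k * p + k) x        ≡⟨ cong (λ z → iter P z x) (trans (+-comm (k * p) k) (sym (*-suc k p))) ⟩
      iter P (k * suc p) x        ≡⟨ iter-periodic P (suc p) x ep k ⟩
      x                           ∎)
    where open ≡-Reasoning

  bounded-cycle : ∀ {x y} → SameCycle π x y → ∃ λ k → k < n × iter P k x ≡ y
  bounded-cycle {x} {y} (k , e) with period x
  ... | suc p , _ , p≤n , ep = r , <-≤-trans (m%n<n k (suc p)) p≤n , (begin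
      iter P r x                             ≡⟨ cong (iter P r) (sym (iter-periodic P (suc p) x ep q)) ⟩
      iter P r (iter P (q * suc p) x)        ≡⟨ sym (iter-+ P r (q * suc p) x) ⟩
      iter P (r + q * suc p) x               ≡⟨ cong (λ z → iter P z x) (sym (m≡m%n+[m/n]*n k (suc p))) ⟩
      iter P k x                             ≡⟨ e ⟩
      y                                      ∎)
    where
    open ≡-Reasoning
    r = k % suc p
    q = k / suc p

  same-cycle? : ∀ x y → Dec (SameCycle π x y)
  same-cycle? x y with any? (λ (i : Fin n) → iter P (toℕ i) x ≟ᶠ y)
  ... | yes (i , e) = yes (toℕ i , e)
  ... | no none     = no λ s → let (k , k<n , e) = bounded-cycle s in
          none (fromℕ< k<n , trans (cong (λ z → iter P z x) (toℕ-fromℕ< k<n)) e)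

  cycleSetoid : Setoid 0ℓ 0ℓ
  cycleSetoid = record
    { Carrier       = Fin n
    ; _≈_           = SameCycle π
    ; isEquivalence = record { refl = refl-cycle ; sym = sym-cycle ; trans = trans-cycle }
    }

open Cycles

module Counting {c ℓ} (S : Setoid c ℓ) where

  open Setoid S using (_≈_) renaming (Carrier to A; sym to ≈-sym; trans to ≈-trans)
  open import Data.List.Membership.Setoid S using (_∈_)
  open import Data.List.Relation.Unary.Unique.Setoid S using (Unique)

  ∈-─ : ∀ {a x} {ys : List A} (p : a ∈ ys) → x ∈ ys → ¬ a ≈ x → x ∈ (ys ─ p)
  ∈-─ (here a≈y) (here x≈y) a≉x = ⊥-elim (a≉x (≈-trans a≈y (≈-sym x≈y)))
  ∈-─ (here _)   (there q)  a≉x = q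
  ∈-─ (there p)  (here x≈y) a≉x = here x≈y
  ∈-─ (there p)  (there q)  a≉x = there (∈-─ p q a≉x)

  unique-length-≤ : ∀ {xs ys : List A} → Unique xs → All (_∈ ys) xs → length xs ≤ length ys
  unique-length-≤ {[]}     []           []         = z≤n
  unique-length-≤ {a ∷ as} {ys} (a≉as ∷ as!) (a∈ys ∷ as⊆ys) =
    subst (suc (length as) ≤_) (sym (length-removeAt′ ys (Any.index a∈ys)))
      (s≤s (unique-length-≤ as! (All.zipWith (λ (x∈ys , a≉x) → ∈-─ a∈ys x∈ys a≉x) (as⊆ys , a≉as))))

Invariant : ∀ {n} → Permutation′ n → (Fin n → Set) → Set
Invariant π Q = ∀ {x y} → SameCycle π x y → Q x → Q y

∁-invariant : ∀ {n} (π : Permutation′ n) {Q : Fin n → Set} → Invariant π Q → Invariant π (λ x → ¬ Q x)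
∁-invariant π inv s ¬qx qy = ¬qx (inv (sym-cycle π s) qy)

invariant-separates : ∀ {n} {π : Permutation′ n} {Q : Fin n → Set} → Invariant π Q →
                      ∀ {x y} → Q x → ¬ Q y → ¬ SameCycle π x y
invariant-separates inv qx ¬qy s = ¬qy (inv s qx)

record CycleReps {n} (π : Permutation′ n) (P : Fin n → Set) (L : List (Fin n)) : Set where
  field
    distinct : AllPairs (λ a b → ¬ SameCycle π a b) L
    inside   : All P L
    covers   : ∀ x → P x → Any (SameCycle π x) L

Everywhere : ∀ {n} → Fin n → Set
Everywhere _ = ⊤

allPairs-mapᴾ : ∀ {A : Set} {P : A → Set} {R S : A → A → Set} →
                (∀ {x y} → P x → R x y → S x y) → ∀ {xs} → All P xs → AllPairs R xs → AllPairs S xs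
allPairs-mapᴾ f []         []         = []
allPairs-mapᴾ f (px ∷ pxs) (rx ∷ rxs) = All.map (f px) rx ∷ allPairs-mapᴾ f pxs rxs

module _ {n : ℕ} {π : Permutation′ n} where

  reps-length : ∀ {P L L'} → CycleReps π P L → CycleReps π P L' → length L ≡ length L'
  reps-length R R' = ≤-antisym (≤-by R R') (≤-by R' R)
    where
    open Counting (cycleSetoid π)
    ≤-by : ∀ {P L L'} → CycleReps π P L → CycleReps π P L' → length L ≤ length L'
    ≤-by R R' = unique-length-≤ (CycleReps.distinct R)
                  (All.map (λ {x} px → CycleReps.covers R' x px) (CycleReps.inside R))

  reps-resp : ∀ {P P' L} → (∀ {x} → P x → P' x) → (∀ {x} → P' x → P x) →
              CycleReps π P L → CycleReps π P' L
  reps-resp to from R = record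
    { distinct = distinct ; inside = All.map to inside ; covers = λ x p' → covers x (from p') }
    where open CycleReps R

  reps-filter : ∀ {P L} {Q : Fin n → Set} (Q? : Decidable Q) → Invariant π Q →
                CycleReps π P L → CycleReps π (λ x → P x × Q x) (filter Q? L)
  reps-filter {L = L} Q? inv R = record
    { distinct = APP.filter⁺ Q? distinct
    ; inside   = All.zip (AllP.filter⁺ Q? inside , AllP.all-filter Q? L)
    ; covers   = covers′
    }
    where
    open CycleReps R
    covers′ : ∀ x → _ → Any (SameCycle π x) (filter Q? L)
    covers′ x (px , qx) with AnyP.filter⁺ Q? (covers x px)
    ... | inj₁ kept    = kept
    ... | inj₂ dropped = ⊥-elim (dropped (inv (AnyP.lookup-result (covers x px)) qx))

  reps-++ : ∀ {P Q L L'} → CycleReps π P L → CycleReps π Q L' →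
            (∀ {x y} → P x → Q y → ¬ SameCycle π x y) → CycleReps π (λ x → P x ⊎ Q x) (L ++ L')
  reps-++ {L = L} R R' separated = record
    { distinct = APP.++⁺ (distinct R) (distinct R')
                   (All.map (λ px → All.map (separated px) (inside R')) (inside R))
    ; inside   = AllP.++⁺ (All.map inj₁ (inside R)) (All.map inj₂ (inside R'))
    ; covers   = λ { x (inj₁ px) → AnyP.++⁺ˡ (covers R x px)
                   ; x (inj₂ qx) → AnyP.++⁺ʳ L (covers R' x qx) }
    }
    where open CycleReps

  reps-complement : ∀ {Q : Fin n → Set} {F O} → Decidable Q → Invariant π Q →
                    CycleReps π Q F → CycleReps π (λ x → ¬ Q x) O → CycleReps π Everywhere (F ++ O)
  reps-complement Q? inv R O =
    reps-resp _ (λ {x} _ → toSum (Q? x)) (reps-++ R O (invariant-separates {π = π} inv))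

transpose-left : ∀ {n} (i j : Fin n) → PC.transpose i j i ≡ j
transpose-left i j with i ≟ᶠ i
... | yes _  = refl
... | no i≢i = ⊥-elim (i≢i refl)

transpose-right : ∀ {n} (i j : Fin n) → PC.transpose i j j ≡ i
transpose-right i j with j ≟ᶠ i
... | yes j≡i = j≡i
... | no _ with j ≟ᶠ j
...   | yes _  = refl
...   | no j≢j = ⊥-elim (j≢j refl)

transpose-other : ∀ {n} (i j k : Fin n) → k ≢ i → k ≢ j → PC.transpose i j k ≡ k
transpose-other i j k k≢i k≢j with k ≟ᶠ i
... | yes k≡i = ⊥-elim (k≢i k≡i)
... | no _ with k ≟ᶠ j
...   | yes k≡j = ⊥-elim (k≢j k≡j)
...   | no _    = refl

transpose-same : ∀ {n} (i k : Fin n) → PC.transpose i i k ≡ k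
transpose-same i k = by-cases (k ≟ᶠ i)
  where
  by-cases : Dec (k ≡ i) → PC.transpose i i k ≡ k
  by-cases (yes refl) = transpose-left k k
  by-cases (no k≢i)   = transpose-other i i k k≢i k≢i

transpose-sym : ∀ {n} (i j k : Fin n) → PC.transpose i j k ≡ PC.transpose j i k
transpose-sym i j k = by-cases (k ≟ᶠ i) (k ≟ᶠ j)
  where
  by-cases : Dec (k ≡ i) → Dec (k ≡ j) → PC.transpose i j k ≡ PC.transpose j i k
  by-cases (yes refl) _          = trans (transpose-left k j) (sym (transpose-right j k))
  by-cases (no _)     (yes refl) = trans (transpose-right i k) (sym (transpose-left k i))
  by-cases (no k≢i)   (no k≢j)   =
    trans (transpose-other i j k k≢i k≢j) (sym (transpose-other j i k k≢j k≢i))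

transpose-involutive : ∀ {n} (i j k : Fin n) → PC.transpose i j (PC.transpose i j k) ≡ k
transpose-involutive i j k =
  trans (cong (PC.transpose i j) (transpose-sym i j k)) (PC.transpose-inverse i j)

-- Cutting 0 out of a permutation π of Fin (suc n): `shortcut π` is the
-- permutation of Fin n sending j to π (suc j), except that the preimage of 0
-- is sent on to π 0 (everything renumbered by suc).
bypass : ∀ {n} → Fin (suc n) → Fin (suc n) → Fin (suc n)
bypass zero    y = y
bypass (suc k) y = suc k

bypass-nonzero : ∀ {n} {x : Fin (suc n)} (y : Fin (suc n)) → x ≢ zero → bypass x y ≡ x
bypass-nonzero {x = zero}  y x≢0 = ⊥-elim (x≢0 refl)
bypass-nonzero {x = suc _} y x≢0 = refl

abstract
  shortcut : ∀ {n} → Permutation′ (suc n) → Permutation′ n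
  shortcut π = remove zero (transpose zero (π ⟨$⟩ˡ zero) ∘ₚ π)

  -- The defining property of shortcut; nothing else about it is used.
  shortcut-spec : ∀ {n} (π : Permutation′ (suc n)) (j : Fin n) →
                  suc (shortcut π ⟨$⟩ʳ j) ≡ bypass (π ⟨$⟩ʳ suc j) (π ⟨$⟩ʳ zero)
  shortcut-spec {n} π j = trans (cong (λ z → punchIn z (shortcut π ⟨$⟩ʳ j)) (sym ρ0≡0))
                            (trans (punchIn-punchOut _) (ρ-suc (suc j ≟ᶠ p)))
    where
    p : Fin (suc n)
    p = π ⟨$⟩ˡ zero
    ρ : Permutation′ (suc n)
    ρ = transpose zero p ∘ₚ π
    ρ0≡0 : ρ ⟨$⟩ʳ zero ≡ zero
    ρ0≡0 = trans (cong (π ⟨$⟩ʳ_) (transpose-left zero p)) (inverseʳ π)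
    ρ-suc : Dec (suc j ≡ p) → ρ ⟨$⟩ʳ suc j ≡ bypass (π ⟨$⟩ʳ suc j) (π ⟨$⟩ʳ zero)
    ρ-suc (yes sj≡p) =
      trans (cong (π ⟨$⟩ʳ_) (trans (cong (PC.transpose zero p) sj≡p) (transpose-right zero p)))
            (sym (cong (λ z → bypass z (π ⟨$⟩ʳ zero)) (preimage π (sym sj≡p))))
    ρ-suc (no sj≢p) with π ⟨$⟩ʳ suc j in eq
    ... | zero  = ⊥-elim (sj≢p (perm-injective π (trans eq (sym (inverseʳ π)))))
    ... | suc _ = trans (cong (π ⟨$⟩ʳ_) (transpose-other zero p (suc j) (λ ()) sj≢p)) eq

shortcut-≈ : ∀ {n} {π ρ : Permutation′ (suc n)} {σ : Permutation′ n} →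
  (∀ j → bypass (ρ ⟨$⟩ʳ suc j) (ρ ⟨$⟩ʳ zero) ≡ bypass (π ⟨$⟩ʳ suc (σ ⟨$⟩ʳ j)) (π ⟨$⟩ʳ zero)) →
  shortcut ρ ≈ₚ σ ∘ₚ shortcut π
shortcut-≈ {π = π} {ρ} {σ} h j =
  suc-injective (trans (shortcut-spec ρ j) (trans (h j) (sym (shortcut-spec π (σ ⟨$⟩ʳ j)))))

module Shortcut {n : ℕ} (π : Permutation′ (suc n)) where

  private
    P : Fin (suc n) → Fin (suc n)
    P = π ⟨$⟩ʳ_
    S : Fin n → Fin n
    S = shortcut π ⟨$⟩ʳ_

  shortcut-next : ∀ j → P (suc j) ≡ suc (S j) ⊎ (P (suc j) ≡ zero × P zero ≡ suc (S j))
  shortcut-next j with P (suc j) in eq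
  ... | zero  = inj₂ (refl , sym (trans (shortcut-spec π j) (cong (λ z → bypass z (P zero)) eq)))
  ... | suc y = inj₁ (sym (trans (shortcut-spec π j) (cong (λ z → bypass z (P zero)) eq)))

  shortcut-step : ∀ j → SameCycle π (suc j) (suc (S j))
  shortcut-step j with shortcut-next j
  ... | inj₁ direct        = 1 , direct
  ... | inj₂ (to0 , from0) = 2 , trans (cong P to0) from0

  shortcut⇒cycle : ∀ {j k} → SameCycle (shortcut π) j k → SameCycle π (suc j) (suc k)
  shortcut⇒cycle (zero  , refl) = refl-cycle π
  shortcut⇒cycle (suc k , refl) = trans-cycle π (shortcut⇒cycle (k , refl)) (shortcut-step _)

  cycle⇒shortcut : ∀ k {j j'} → iter P k (suc j) ≡ suc j' → SameCycle (shortcut π) j j'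
  cycle⇒shortcut zero e = 0 , suc-injective e
  cycle⇒shortcut (suc k) {j} e with shortcut-next j
  cycle⇒shortcut (suc k) {j} e | inj₁ direct =
    trans-cycle (shortcut π) (step-cycle (shortcut π) j)
      (cycle⇒shortcut k (trans (cong (iter P k) (sym direct)) (trans (sym (iter-suc P k (suc j))) e)))
  cycle⇒shortcut (suc zero) {j} e | inj₂ (to0 , _) = ⊥-elim (0≢1+n (trans (sym to0) e))
  cycle⇒shortcut (suc (suc k)) {j} e | inj₂ (to0 , from0) =
    trans-cycle (shortcut π) (step-cycle (shortcut π) j)
      (cycle⇒shortcut k (begin
        iter P k (suc (S j))         ≡⟨ cong (iter P k) (trans (sym from0) (cong P (sym to0))) ⟩
        iter P k (P (P (suc j)))     ≡⟨ sym (iter-suc P k (P (suc j))) ⟩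
        iter P (suc k) (P (suc j))   ≡⟨ sym (iter-suc P (suc k) (suc j)) ⟩
        iter P (suc (suc k)) (suc j) ≡⟨ e ⟩
        suc _                        ∎))
    where open ≡-Reasoning

  fixed-zero : P zero ≡ zero → ∀ {x} → SameCycle π zero x → x ≡ zero
  fixed-zero p0 (zero  , e) = sym e
  fixed-zero p0 (suc k , e) = trans (sym e) (trans (cong P (fixed-zero p0 (k , refl))) p0)

open Shortcut

-- The number of cycles, computed by cutting out 0: if 0 is a fixed point
-- its cycle disappears, otherwise 0 is removed from its cycle.
isZero : ∀ {n} → Fin n → ℕ
isZero zero    = 1
isZero (suc _) = 0

isZero-nonzero : ∀ {n} {x : Fin (suc n)} → x ≢ zero → isZero x ≡ 0
isZero-nonzero {x = zero}  x≢0 = ⊥-elim (x≢0 refl)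
isZero-nonzero {x = suc _} x≢0 = refl

cycles : ∀ {n} → Permutation′ n → ℕ
cycles {zero}  π = 0
cycles {suc n} π = isZero (π ⟨$⟩ʳ zero) + cycles (shortcut π)

cycles-cong : ∀ {n} {π ρ : Permutation′ n} → π ≈ₚ ρ → cycles π ≡ cycles ρ
cycles-cong {zero}  e = refl
cycles-cong {suc n} e = cong₂ _+_ (cong isZero (e zero))
  (cycles-cong (shortcut-≈ {σ = id} λ j → cong₂ bypass (e (suc j)) (e zero)))

allCycleReps : ∀ {n} (π : Permutation′ n) →
               Σ (List (Fin n)) λ L → CycleReps π Everywhere L × length L ≡ cycles π
allCycleReps {zero}  π = [] , record { distinct = [] ; inside = [] ; covers = λ () } , refl
allCycleReps {suc n} π = by-image-of-0 (π ⟨$⟩ʳ zero) refl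
  where
  L : List (Fin n)
  L = proj₁ (allCycleReps (shortcut π))
  reps : CycleReps (shortcut π) Everywhere L
  reps = proj₁ (proj₂ (allCycleReps (shortcut π)))
  L⁺ : List (Fin (suc n))
  L⁺ = map suc L

  distinct⁺ : AllPairs (λ a b → ¬ SameCycle π a b) L⁺
  distinct⁺ = APP.map⁺ (AP.map (λ ¬s s → ¬s (cycle⇒shortcut π (proj₁ s) (proj₂ s)))
                                (CycleReps.distinct reps))

  covers⁺ : ∀ j → Any (SameCycle π (suc j)) L⁺
  covers⁺ j = AnyP.map⁺ (Any.map (shortcut⇒cycle π) (CycleReps.covers reps j tt))

  length⁺ : length L⁺ ≡ cycles (shortcut π)
  length⁺ = trans (length-map suc L) (proj₂ (proj₂ (allCycleReps (shortcut π))))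

  by-image-of-0 : ∀ y → π ⟨$⟩ʳ zero ≡ y → Σ (List (Fin (suc n))) λ L →
                  CycleReps π Everywhere L × length L ≡ isZero y + cycles (shortcut π)
  by-image-of-0 zero p0 = zero ∷ L⁺ , record
    { distinct = AllP.map⁺ (All.universal (λ b s → 0≢1+n (sym (fixed-zero π p0 s))) L) ∷ distinct⁺
    ; inside   = All.universal _ _
    ; covers   = covers
    } , cong suc length⁺
    where
    covers : ∀ x → ⊤ → Any (SameCycle π x) (zero ∷ L⁺)
    covers zero    _ = here (refl-cycle π)
    covers (suc j) _ = there (covers⁺ j)
  by-image-of-0 (suc y) p0 = L⁺ , record
    { distinct = distinct⁺ ; inside = All.universal _ _ ; covers = covers } , length⁺
    where
    covers : ∀ x → ⊤ → Any (SameCycle π x) L⁺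
    covers zero    _ = Any.map (trans-cycle π (1 , p0)) (covers⁺ y)
    covers (suc j) _ = covers⁺ j

cycles-by-reps : ∀ {n} {π : Permutation′ n} {L} → CycleReps π Everywhere L → cycles π ≡ length L
cycles-by-reps {π = π} R = let (_ , R′ , count) = allCycleReps π in trans (sym count) (reps-length R′ R)

-- Composing π with the transposition (0 B), B = suc b: the values of π at 0
-- and B are exchanged.
module SwapWithZero {n : ℕ} (π : Permutation′ (suc n)) (b : Fin n) where

  B : Fin (suc n)
  B = suc b

  ρ : Permutation′ (suc n)
  ρ = transpose zero B ∘ₚ π

  private
    πᶠ ρᶠ : Fin (suc n) → Fin (suc n)
    πᶠ = π ⟨$⟩ʳ_
    ρᶠ = ρ ⟨$⟩ʳ_

  ρ-0 : ρᶠ zero ≡ πᶠ B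
  ρ-0 = cong πᶠ (transpose-left zero B)

  ρ-B : ρᶠ B ≡ πᶠ zero
  ρ-B = cong πᶠ (transpose-right zero B)

  ρ-other : ∀ j → j ≢ b → ρᶠ (suc j) ≡ πᶠ (suc j)
  ρ-other j j≢b = cong πᶠ (transpose-other zero B (suc j) (0≢1+n ∘ sym) (j≢b ∘ suc-injective))

  -- If π fixes 0, then ρ merges the cycle {0} into the cycle of B.
  cycles-fixed0 : πᶠ zero ≡ zero → cycles π ≡ suc (cycles ρ)
  cycles-fixed0 π0≡0 = begin
    isZero (πᶠ zero) + cycles (shortcut π)  ≡⟨ cong (λ z → isZero z + cycles (shortcut π)) π0≡0 ⟩
    suc (cycles (shortcut π))               ≡⟨ cong suc (cycles-cong (shortcut-≈ {σ = id} agrees)) ⟩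
    suc (cycles (shortcut ρ))               ≡⟨ cong (λ z → suc (z + cycles (shortcut ρ))) (sym (isZero-nonzero ρ0≢0)) ⟩
    suc (cycles ρ)                          ∎
    where
    open ≡-Reasoning
    πj≢0 : ∀ {j} → πᶠ (suc j) ≢ zero
    πj≢0 e = 0≢1+n (perm-injective π (trans π0≡0 (sym e)))
    ρ0≢0 : ρᶠ zero ≢ zero
    ρ0≢0 e = πj≢0 (trans (sym ρ-0) e)
    agrees : ∀ j → bypass (πᶠ (suc j)) (πᶠ zero) ≡ bypass (ρᶠ (suc j)) (ρᶠ zero)
    agrees j = by-cases (j ≟ᶠ b)
      where
      by-cases : Dec (j ≡ b) → bypass (πᶠ (suc j)) (πᶠ zero) ≡ bypass (ρᶠ (suc j)) (ρᶠ zero)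
      by-cases (yes refl) = begin
        bypass (πᶠ B) (πᶠ zero)  ≡⟨ bypass-nonzero _ πj≢0 ⟩
        πᶠ B                     ≡⟨ sym ρ-0 ⟩
        bypass zero (ρᶠ zero)    ≡⟨ cong (λ z → bypass z (ρᶠ zero)) (sym (trans ρ-B π0≡0)) ⟩
        bypass (ρᶠ B) (ρᶠ zero)  ∎
      by-cases (no j≢b) = begin
        bypass (πᶠ (suc j)) (πᶠ zero)  ≡⟨ bypass-nonzero _ πj≢0 ⟩
        πᶠ (suc j)                     ≡⟨ sym (ρ-other j j≢b) ⟩
        ρᶠ (suc j)                     ≡⟨ sym (bypass-nonzero _ (πj≢0 ∘ trans (sym (ρ-other j j≢b)))) ⟩
        bypass (ρᶠ (suc j)) (ρᶠ zero)  ∎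

  -- If neither 0 nor B is mapped to 0, let suc c be the preimage of 0.
  -- Then cutting 0 out of ρ amounts to composing shortcut π with (b c).
  shortcut-moved0 : ∀ c → πᶠ (suc c) ≡ zero → b ≢ c → shortcut ρ ≈ₚ transpose b c ∘ₚ shortcut π
  shortcut-moved0 c πc≡0 b≢c = shortcut-≈ {π = π} {ρ} {transpose b c} (λ j → by-cases j (j ≟ᶠ b) (j ≟ᶠ c))
    where
    open ≡-Reasoning
    τ : Fin n → Fin n
    τ = PC.transpose b c
    π0≢0 : πᶠ zero ≢ zero
    π0≢0 e = 0≢1+n (perm-injective π (trans e (sym πc≡0)))
    πj≢0 : ∀ {j} → j ≢ c → πᶠ (suc j) ≢ zero
    πj≢0 j≢c e = j≢c (suc-injective (perm-injective π (trans e (sym πc≡0))))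
    by-cases : ∀ j → Dec (j ≡ b) → Dec (j ≡ c) →
               bypass (ρᶠ (suc j)) (ρᶠ zero) ≡ bypass (πᶠ (suc (τ j))) (πᶠ zero)
    by-cases j (yes refl) _ = begin
      bypass (ρᶠ B) (ρᶠ zero)              ≡⟨ cong (λ z → bypass z (ρᶠ zero)) ρ-B ⟩
      bypass (πᶠ zero) (ρᶠ zero)           ≡⟨ bypass-nonzero _ π0≢0 ⟩
      bypass zero (πᶠ zero)                ≡⟨ cong (λ z → bypass z (πᶠ zero)) (sym πc≡0) ⟩
      bypass (πᶠ (suc c)) (πᶠ zero)        ≡⟨ cong (λ z → bypass (πᶠ (suc z)) (πᶠ zero)) (sym (transpose-left b c)) ⟩
      bypass (πᶠ (suc (τ b))) (πᶠ zero)    ∎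
    by-cases j (no j≢b) (yes refl) = begin
      bypass (ρᶠ (suc c)) (ρᶠ zero)        ≡⟨ cong (λ z → bypass z (ρᶠ zero)) (trans (ρ-other c j≢b) πc≡0) ⟩
      ρᶠ zero                              ≡⟨ ρ-0 ⟩
      πᶠ B                                 ≡⟨ sym (bypass-nonzero _ (πj≢0 b≢c)) ⟩
      bypass (πᶠ B) (πᶠ zero)              ≡⟨ cong (λ z → bypass (πᶠ (suc z)) (πᶠ zero)) (sym (transpose-right b c)) ⟩
      bypass (πᶠ (suc (τ c))) (πᶠ zero)    ∎
    by-cases j (no j≢b) (no j≢c) = begin
      bypass (ρᶠ (suc j)) (ρᶠ zero)        ≡⟨ cong (λ z → bypass z (ρᶠ zero)) (ρ-other j j≢b) ⟩
      bypass (πᶠ (suc j)) (ρᶠ zero)        ≡⟨ bypass-nonzero _ (πj≢0 j≢c) ⟩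
      πᶠ (suc j)                           ≡⟨ sym (bypass-nonzero _ (πj≢0 j≢c)) ⟩
      bypass (πᶠ (suc j)) (πᶠ zero)        ≡⟨ cong (λ z → bypass (πᶠ (suc z)) (πᶠ zero))
                                                   (sym (transpose-other b c j j≢b j≢c)) ⟩
      bypass (πᶠ (suc (τ j))) (πᶠ zero)    ∎

  cycles-moved0 : ∀ c → πᶠ (suc c) ≡ zero → b ≢ c →
                  cycles π ≡ cycles (shortcut π) × cycles ρ ≡ cycles (transpose b c ∘ₚ shortcut π)
  cycles-moved0 c πc≡0 b≢c =
    cong (_+ cycles (shortcut π)) (isZero-nonzero π0≢0) ,
    cong₂ _+_ (isZero-nonzero ρ0≢0) (cycles-cong (shortcut-moved0 c πc≡0 b≢c))
    where
    π0≢0 : πᶠ zero ≢ zero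
    π0≢0 e = 0≢1+n (perm-injective π (trans e (sym πc≡0)))
    ρ0≢0 : ρᶠ zero ≢ zero
    ρ0≢0 e = b≢c (suc-injective (perm-injective π (trans (sym ρ-0) (trans e (sym πc≡0)))))

-- If π maps B to 0, then ρ fixes 0, and swapping back recovers π.
cycles-fixedB : ∀ {n} (π : Permutation′ (suc n)) (b : Fin n) → π ⟨$⟩ʳ suc b ≡ zero →
                cycles (SwapWithZero.ρ π b) ≡ suc (cycles π)
cycles-fixedB π b πB≡0 = trans (SwapWithZero.cycles-fixed0 ρ b (trans ρ-0 πB≡0))
  (cong suc (cycles-cong (λ k → cong (π ⟨$⟩ʳ_) (transpose-involutive zero B k))))
  where open SwapWithZero π b

cycleParity : ∀ {n} → Permutation′ n → Parity
cycleParity π = parity (cycles π)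

parity-suc : ∀ m → parity (suc m) ≡ parity m ⁻¹
parity-suc m = trans (sym (ℙ.⁻¹-involutive _)) (cong _⁻¹ (ℙ.suc-homo-⁻¹ m))

+-⁻¹ : ∀ p q → p +ℙ q ⁻¹ ≡ (p +ℙ q) ⁻¹
+-⁻¹ 0ℙ q = refl
+-⁻¹ 1ℙ q = refl

⁻¹-+ : ∀ p q → p ⁻¹ +ℙ q ≡ (p +ℙ q) ⁻¹
⁻¹-+ 0ℙ q = refl
⁻¹-+ 1ℙ q = sym (ℙ.⁻¹-involutive q)

-- Composing with a transposition flips the parity of the number of cycles.
-- By induction on n: transpositions avoiding 0 commute with shortcut, and
-- those moving 0 are handled by SwapWithZero.
cycleParity-transpose : ∀ {n} {a b : Fin n} → a ≢ b → ∀ π →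
                        cycleParity (transpose a b ∘ₚ π) ≡ cycleParity π ⁻¹
cycleParity-swap0 : ∀ {n} (b : Fin n) π → cycleParity (transpose zero (suc b) ∘ₚ π) ≡ cycleParity π ⁻¹

cycleParity-transpose {a = zero}  {zero}  a≢b π = ⊥-elim (a≢b refl)
cycleParity-transpose {a = zero}  {suc b} _   π = cycleParity-swap0 b π
cycleParity-transpose {a = suc a} {zero}  _   π =
  trans (cong parity (cycles-cong (λ k → cong (π ⟨$⟩ʳ_) (transpose-sym (suc a) zero k))))
        (cycleParity-swap0 a π)
cycleParity-transpose {a = suc a} {suc b} a≢b π = begin
  cycleParity ρ                                  ≡⟨ cong parity (cong₂ _+_ (cong isZero ρ-0) (cycles-cong lifted)) ⟩
  parity (z + cycles (transpose a b ∘ₚ shortcut π)) ≡⟨ ℙ.+-homo-+ z _ ⟩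
  parity z +ℙ cycleParity (transpose a b ∘ₚ shortcut π)
                                                 ≡⟨ cong (parity z +ℙ_) (cycleParity-transpose (a≢b ∘ cong suc) (shortcut π)) ⟩
  parity z +ℙ cycleParity (shortcut π) ⁻¹        ≡⟨ +-⁻¹ (parity z) _ ⟩
  (parity z +ℙ cycleParity (shortcut π)) ⁻¹      ≡⟨ cong _⁻¹ (sym (ℙ.+-homo-+ z _)) ⟩
  cycleParity π ⁻¹                               ∎
  where
  open ≡-Reasoning
  z = isZero (π ⟨$⟩ʳ zero)
  ρ = transpose (suc a) (suc b) ∘ₚ π
  ρ-0 : ρ ⟨$⟩ʳ zero ≡ π ⟨$⟩ʳ zero
  ρ-0 = cong (π ⟨$⟩ʳ_) (lift₀-transpose a b zero)
  lifted : shortcut ρ ≈ₚ transpose a b ∘ₚ shortcut π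
  lifted = shortcut-≈ {π = π} {ρ} {transpose a b}
             (λ j → cong₂ bypass (cong (π ⟨$⟩ʳ_) (lift₀-transpose a b (suc j))) ρ-0)

cycleParity-swap0 b π with π ⟨$⟩ˡ zero in eq
... | zero = sym (trans (cong (λ m → parity m ⁻¹) (SwapWithZero.cycles-fixed0 π b (preimage π eq)))
                        (ℙ.suc-homo-⁻¹ (cycles (SwapWithZero.ρ π b))))
... | suc c with b ≟ᶠ c
...   | yes refl = trans (cong parity (cycles-fixedB π b (preimage π eq))) (parity-suc (cycles π))
...   | no b≢c   = begin
  cycleParity (SwapWithZero.ρ π b)           ≡⟨ cong parity (proj₂ moved) ⟩
  cycleParity (transpose b c ∘ₚ shortcut π)  ≡⟨ cycleParity-transpose b≢c (shortcut π) ⟩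
  cycleParity (shortcut π) ⁻¹                ≡⟨ cong (λ m → parity m ⁻¹) (sym (proj₁ moved)) ⟩
  cycleParity π ⁻¹                           ∎
  where
  open ≡-Reasoning
  moved = SwapWithZero.cycles-moved0 π b c (preimage π eq) b≢c

flipUnless : ∀ {n} {a b : Fin n} → Dec (a ≡ b) → Parity → Parity
flipUnless (yes _) p = p
flipUnless (no _)  p = p ⁻¹

nontrivial : ∀ {n} → TranspositionList n → Parity
nontrivial []             = 0ℙ
nontrivial ((a , b) ∷ xs) = flipUnless (a ≟ᶠ b) (nontrivial xs)

cycleParity-eval : ∀ {n} (xs : TranspositionList n) (π : Permutation′ n) →
                   cycleParity (eval xs ∘ₚ π) ≡ nontrivial xs +ℙ cycleParity π
cycleParity-eval []             π = cong parity (cycles-cong {π = id ∘ₚ π} {π} λ _ → refl)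
cycleParity-eval ((a , b) ∷ xs) π =
  trans (cong parity (cycles-cong {π = eval ((a , b) ∷ xs) ∘ₚ π} {transpose a b ∘ₚ (eval xs ∘ₚ π)} λ _ → refl))
        (by-cases (a ≟ᶠ b))
  where
  by-cases : (d : Dec (a ≡ b)) →
             cycleParity (transpose a b ∘ₚ (eval xs ∘ₚ π)) ≡ flipUnless d (nontrivial xs) +ℙ cycleParity π
  by-cases (yes refl) =
    trans (cong parity (cycles-cong (λ k → cong ((eval xs ∘ₚ π) ⟨$⟩ʳ_) (transpose-same a k))))
          (cycleParity-eval xs π)
  by-cases (no a≢b) =
    trans (cycleParity-transpose a≢b (eval xs ∘ₚ π))
          (trans (cong _⁻¹ (cycleParity-eval xs π)) (sym (⁻¹-+ (nontrivial xs) _)))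

-- Since every permutation is a product of transpositions, the cycle parity
-- of σ ∘ π is determined by those of σ and of π.
cycleParity-∘ : ∀ {n} (σ π : Permutation′ n) →
                cycleParity (σ ∘ₚ π) ≡ (cycleParity σ +ℙ cycleParity (id {n})) +ℙ cycleParity π
cycleParity-∘ {n} σ π = begin
  cycleParity (σ ∘ₚ π)                   ≡⟨ via-decomposition π ⟩
  w +ℙ cycleParity π                     ≡⟨ cong (_+ℙ cycleParity π) (sym w-cancel) ⟩
  ((w +ℙ i) +ℙ i) +ℙ cycleParity π       ≡⟨ cong (λ p → (p +ℙ i) +ℙ cycleParity π) (sym (via-decomposition id)) ⟩
  (cycleParity σ +ℙ i) +ℙ cycleParity π  ∎
  where
  open ≡-Reasoning
  w = nontrivial (decompose σ)
  i = cycleParity (id {n})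
  via-decomposition : ∀ π → cycleParity (σ ∘ₚ π) ≡ w +ℙ cycleParity π
  via-decomposition π =
    trans (cong parity (cycles-cong (λ x → cong (π ⟨$⟩ʳ_) (sym (eval-decompose σ x)))))
          (cycleParity-eval (decompose σ) π)
  w-cancel : (w +ℙ i) +ℙ i ≡ w
  w-cancel = trans (ℙ.+-assoc w i i) (trans (cong (w +ℙ_) (ℙ.p+p≡0ℙ i)) (ℙ.+-identityʳ w))

-- Let π₁ and π₂ agree
-- outside a region Q that is a union of cycles of π₁.  The cycles outside Q
-- are then common to both, so if F₁ and F₂ represent the cycles of π₁ and
-- π₂ inside Q, the total numbers of cycles differ by |F₁| - |F₂|.
module LocalChange {n : ℕ} (π₁ π₂ : Permutation′ n) {Q : Fin n → Set} (Q? : Decidable Q)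
                   (Q-invariant : Invariant π₁ Q) (agree : ∀ x → ¬ Q x → π₁ ⟨$⟩ʳ x ≡ π₂ ⟨$⟩ʳ x) where

  -- Orbits starting outside Q stay outside Q, where π₁ and π₂ agree.
  outside-orbit : ∀ {x} → ¬ Q x → ∀ k → iter (π₁ ⟨$⟩ʳ_) k x ≡ iter (π₂ ⟨$⟩ʳ_) k x
  outside-orbit ¬qx zero    = refl
  outside-orbit ¬qx (suc k) =
    trans (agree _ (∁-invariant π₁ Q-invariant (k , refl) ¬qx)) (cong (π₂ ⟨$⟩ʳ_) (outside-orbit ¬qx k))

  outside₁⇒₂ : ∀ {x y} → ¬ Q x → SameCycle π₁ x y → SameCycle π₂ x y
  outside₁⇒₂ ¬qx (k , e) = k , trans (sym (outside-orbit ¬qx k)) e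

  outside₂⇒₁ : ∀ {x y} → ¬ Q x → SameCycle π₂ x y → SameCycle π₁ x y
  outside₂⇒₁ ¬qx (k , e) = k , trans (outside-orbit ¬qx k) e

  Q-invariant₂ : Invariant π₂ Q
  Q-invariant₂ {x} {y} s qx with Q? y
  ... | yes qy  = qy
  ... | no  ¬qy = ⊥-elim (¬qy (Q-invariant (sym-cycle π₁ (outside₂⇒₁ ¬qy (sym-cycle π₂ s))) qx))

  outside-reps : ∀ {O} → CycleReps π₁ (λ x → ¬ Q x) O → CycleReps π₂ (λ x → ¬ Q x) O
  outside-reps R = record
    { distinct = allPairs-mapᴾ (λ ¬qa ¬s s → ¬s (outside₂⇒₁ ¬qa s)) inside distinct
    ; inside   = inside
    ; covers   = λ x ¬qx → Any.map (outside₁⇒₂ ¬qx) (covers x ¬qx)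
    }
    where open CycleReps R

  cycles-local : ∀ {F₁ F₂} → CycleReps π₁ Q F₁ → CycleReps π₂ Q F₂ →
                 cycles π₁ + length F₂ ≡ cycles π₂ + length F₁
  cycles-local {F₁} {F₂} R₁ R₂ = begin
    cycles π₁ + length F₂               ≡⟨ cong (_+ length F₂) (cycles-by-reps whole₁) ⟩
    length (F₁ ++ O) + length F₂        ≡⟨ cong (_+ length F₂) (length-++ F₁) ⟩
    (length F₁ + length O) + length F₂  ≡⟨ +-comm (length F₁ + length O) (length F₂) ⟩
    length F₂ + (length F₁ + length O)  ≡⟨ cong (length F₂ +_) (+-comm (length F₁) (length O)) ⟩
    length F₂ + (length O + length F₁)  ≡⟨ sym (+-assoc (length F₂) (length O) (length F₁)) ⟩
    (length F₂ + length O) + length F₁  ≡⟨ cong (_+ length F₁) (sym (length-++ F₂)) ⟩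
    length (F₂ ++ O) + length F₁        ≡⟨ cong (_+ length F₁) (sym (cycles-by-reps whole₂)) ⟩
    cycles π₂ + length F₁               ∎
    where
    open ≡-Reasoning
    -- representatives of the cycles of π₁ outside Q; they serve π₂ as well
    O : List (Fin n)
    O = filter (¬? ∘ Q?) (proj₁ (allCycleReps π₁))
    O₁ : CycleReps π₁ (λ x → ¬ Q x) O
    O₁ = reps-resp proj₂ (tt ,_)
           (reps-filter (¬? ∘ Q?) (∁-invariant π₁ Q-invariant) (proj₁ (proj₂ (allCycleReps π₁))))
    whole₁ : CycleReps π₁ Everywhere (F₁ ++ O)
    whole₁ = reps-complement Q? Q-invariant R₁ O₁
    whole₂ : CycleReps π₂ Everywhere (F₂ ++ O)
    whole₂ = reps-complement Q? Q-invariant₂ R₂ (outside-reps O₁)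

-- If π₁ and π₂ agree outside a decidable set P and the π₁-orbit of x meets
-- P, then so does the π₂-orbit of x: both follow the same path until the
-- first entry into P.
orbit-enters : ∀ {n} (π₁ π₂ : Permutation′ n) {P : Fin n → Set} → Decidable P →
               (∀ x → ¬ P x → π₁ ⟨$⟩ʳ x ≡ π₂ ⟨$⟩ʳ x) →
               ∀ k x → P (iter (π₁ ⟨$⟩ʳ_) k x) → ∃ λ z → P z × SameCycle π₂ x z
orbit-enters π₁ π₂ P? agree zero    x p = x , p , refl-cycle π₂
orbit-enters π₁ π₂ {P} P? agree (suc k) x p with P? x
... | yes px = x , px , refl-cycle π₂
... | no ¬px with orbit-enters π₁ π₂ P? agree k (π₁ ⟨$⟩ʳ x) (subst P (iter-suc (π₁ ⟨$⟩ʳ_) k x) p)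
...   | z , pz , s = z , pz , trans-cycle π₂ (step-cycle π₂ x) (subst (λ w → SameCycle π₂ w z) (agree x ¬px) s)

-- The faces of the map (α, β) are the cycles of γ = αβ (first β, then α).
face : ∀ {n} → Permutation′ n → Permutation′ n → Permutation′ n
face α β = β ∘ₚ α

module IncidentRegion {n : ℕ} (α β : Permutation′ n) (v : Fin n) where

  incident? : Decidable (FaceIncident α β v)
  incident? x = any? (λ y → same-cycle? β v y ×-dec same-cycle? (face α β) x y)

  incident-invariant : Invariant (face α β) (FaceIncident α β v)
  incident-invariant s (y , νy , s′) = y , νy , trans-cycle (face α β) (sym-cycle (face α β) s) s′

  vertex⊆incident : ∀ {x} → InVertex β v x → FaceIncident α β v x
  vertex⊆incident νx = _ , νx , refl-cycle (face α β)

  module _ {q : ℕ} {f : Fin q → Fin n} (faces : IncidentFaces α β v q f) where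

    private
      incident = proj₁ faces
      different = proj₁ (proj₂ faces)
      complete = proj₂ (proj₂ faces)

    faces-union : ∀ x → (∃ λ i → SameFace α β (f i) x) ⇔ FaceIncident α β v x
    faces-union x = mk⇔ to (complete x)
      where
      to : (∃ λ i → SameFace α β (f i) x) → FaceIncident α β v x
      to (i , s) = let (y , νy , s′) = incident i in
                   y , νy , trans-cycle (face α β) (sym-cycle (face α β) s) s′

    faces-reps : CycleReps (face α β) (FaceIncident α β v) (tabulate f)
    faces-reps = record
      { distinct = APP.tabulate⁺ (λ {i} {j} i≢j s → i≢j (different i j s))
      ; inside   = AllP.tabulate⁺ incident
      ; covers   = λ x fx → let (i , s) = complete x fx in AnyP.tabulate⁺ i (sym-cycle (face α β) s)
      }

module Reembedded {n : ℕ} (α β β' : Permutation′ n) (v : Fin n) (reembedding : Reembedding β v β') where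

  private
    off-vertex = proj₁ reembedding
    stays-in-vertex = proj₁ (proj₂ reembedding)
    single-cycle = proj₂ (proj₂ reembedding)
  open IncidentRegion

  new-vertex⊆old : ∀ {y} → SameCycle β' v y → InVertex β v y
  new-vertex⊆old (k , refl) = along k
    where
    along : ∀ k → InVertex β v (iter (β' ⟨$⟩ʳ_) k v)
    along zero    = refl-cycle β
    along (suc k) = stays-in-vertex _ (along k)

  faces-agree : ∀ x → ¬ InVertex β v x → face α β ⟨$⟩ʳ x ≡ face α β' ⟨$⟩ʳ x
  faces-agree x ¬νx = cong (α ⟨$⟩ʳ_) (sym (off-vertex x ¬νx))

  incident⇔ : ∀ x → FaceIncident α β v x ⇔ FaceIncident α β' v x
  incident⇔ x = mk⇔ to from
    where
    to : FaceIncident α β v x → FaceIncident α β' v x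
    to (y , νy , k , e) =
      let (z , νz , s) = orbit-enters (face α β) (face α β') (same-cycle? β v) faces-agree k x
                           (subst (InVertex β v) (sym e) νy)
      in z , single-cycle z νz , s
    from : FaceIncident α β' v x → FaceIncident α β v x
    from (y , ν′y , k , e) =
      orbit-enters (face α β') (face α β) (same-cycle? β v) (λ z ¬νz → sym (faces-agree z ¬νz)) k x
        (subst (InVertex β v) (sym e) (new-vertex⊆old ν′y))

  -- β and β' both have the single cycle ν on ν, hence equally many cycles.
  vertex-count : cycles β ≡ cycles β'
  vertex-count = +-cancelʳ-≡ 1 (cycles β) (cycles β')
    (LocalChange.cycles-local β β' (same-cycle? β v) (λ s νx → trans-cycle β νx s)
       (λ x ¬νx → sym (off-vertex x ¬νx)) (single-vertex β (λ _ νx → νx)) (single-vertex β' single-cycle))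
    where
    single-vertex : ∀ π → (∀ x → InVertex β v x → SameCycle π v x) → CycleReps π (InVertex β v) (v ∷ [])
    single-vertex π ν⊆cycle = record
      { distinct = [] ∷ []
      ; inside   = refl-cycle β ∷ []
      ; covers   = λ x νx → here (sym-cycle π (ν⊆cycle x νx))
      }

  -- The faces at ν are the cycles of αβ, resp. αβ', inside one region.
  face-count : ∀ {q f q' f'} → IncidentFaces α β v q f → IncidentFaces α β' v q' f' →
               cycles (face α β) + q' ≡ cycles (face α β') + q
  face-count {q} {f} {q'} {f'} faces faces′ =
    subst₂ (λ a b → cycles (face α β) + a ≡ cycles (face α β') + b) (length-tabulate f') (length-tabulate f)
      (LocalChange.cycles-local (face α β) (face α β') (incident? α β v) (incident-invariant α β v)
         (λ x ¬fx → faces-agree x (¬fx ∘ vertex⊆incident α β v))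
         (faces-reps α β v faces)
         (reps-resp (Equivalence.from (incident⇔ _)) (Equivalence.to (incident⇔ _)) (faces-reps α β' v faces′)))

same-parity⇒%2 : ∀ m n → parity m ≡ parity n → m % 2 ≡ n % 2
same-parity⇒%2 zero          zero          _ = refl
same-parity⇒%2 zero          (suc zero)    ()
same-parity⇒%2 (suc zero)    zero          ()
same-parity⇒%2 (suc zero)    (suc zero)    _ = refl
same-parity⇒%2 (suc (suc m)) n             e = same-parity⇒%2 m n e
same-parity⇒%2 zero          (suc (suc n)) e = same-parity⇒%2 zero n e
same-parity⇒%2 (suc zero)    (suc (suc n)) e = same-parity⇒%2 (suc zero) n e

-- Lemma 4.1.
lemma4p1 : (m : ℕ) (α β β' : Permutation′ (2 * m)) (v : Fin (2 * m)) →
    FPFInvolution α →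
    Reembedding β v β' →
    (q : ℕ) (f : Fin q → Fin (2 * m)) → IncidentFaces α β v q f →
    (q' : ℕ) (f' : Fin q' → Fin (2 * m)) → IncidentFaces α β' v q' f' →
    (∀ x → (∃ λ i → SameFace α β (f i) x) ⇔ (∃ λ i → SameFace α β' (f' i) x))
    × (q % 2 ≡ q' % 2)
lemma4p1 m α β β' v _ reembedding q f faces q' f' faces′ = same-half-edges , same-parity
  where
  open Reembedded α β β' v reembedding
  open IncidentRegion
  γ = face α β
  γ′ = face α β'

  same-half-edges : ∀ x → (∃ λ i → SameFace α β (f i) x) ⇔ (∃ λ i → SameFace α β' (f' i) x)
  same-half-edges x =
    ⇔-trans (faces-union α β v faces x) (⇔-trans (incident⇔ x) (⇔-sym (faces-union α β' v faces′ x)))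

  same-face-parity : cycleParity γ ≡ cycleParity γ′
  same-face-parity = trans (cycleParity-∘ β α)
    (trans (cong (λ p → (parity p +ℙ cycleParity (id {2 * m})) +ℙ cycleParity α) vertex-count)
           (sym (cycleParity-∘ β' α)))

  same-parity : q % 2 ≡ q' % 2
  same-parity = same-parity⇒%2 q q' (sym (ℙ.+-cancelˡ-≡ (cycleParity γ) (parity q') (parity q) (begin
    cycleParity γ +ℙ parity q'   ≡⟨ sym (ℙ.+-homo-+ (cycles γ) q') ⟩
    parity (cycles γ + q')       ≡⟨ cong parity (face-count faces faces′) ⟩
    parity (cycles γ′ + q)       ≡⟨ ℙ.+-homo-+ (cycles γ′) q ⟩
    cycleParity γ′ +ℙ parity q   ≡⟨ cong (_+ℙ parity q) (sym same-face-parity) ⟩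
    cycleParity γ +ℙ parity q    ∎)))
    where open ≡-Reasoning
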